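{- Let $d\geq 3$, let $G$ be a $d$-regular graph, $v$ a vertex of $G$, and $C$ the vertex set of the component containing $v$, with $|C|\geq 2(d+1)$; layer $G$ from $v$ and let $\ell=|V_2|$. Suppose that $G[V_2]$ is complete, $2\leq\ell\leq d-1$, every $u\in V_2$ has $\mathrm{id}(u)=1$, $V_3\neq\emptyset$ and $V_4=\emptyset$. Then there is a $\Delta^-$-switch, all of whose vertices lie in $V_2\cup V_3$, which removes an edge of $G[V_2]$ without altering the edges of $G[V_1]$.
   Context: All graphs are simple. Layering from $v$: for $i\ge0$, $V_i$ is the set of vertices of $C$ at distance exactly $i$ from $v$ (so $V_1={\rm N}(v)$). For $u\in V_i$, $\mathrm{id}(u)=|{\rm N}(u)\cap V_{i-1}|$. A $\Delta^-$-switch: if $p,x,y,w,z$ are distinct vertices, $G$ contains the triangle on $p,x,w$ and the edge $yz$, and $xy, wz$ are non-edges, delete $xw$, $yz$ and insert $xy$, $wz$; its vertices are $p,x,y,w,z$. -}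

module Defs where

open import Data.Nat using (ℕ; zero; suc; _<_; _≤_; _*_; _+_; _∸_)
open import Data.Fin using (Fin)
open import Data.Bool using (Bool; true; false)
open import Data.Product using (Σ; ∃; _×_; _,_)
open import Data.Sum using (_⊎_)
open import Relation.Nullary using (¬_)
open import Relation.Binary.PropositionalEquality using (_≡_; _≢_)
open import Function.Definitions using (Injective)

record Graph (n : ℕ) : Set where
  field
    adj    : Fin n → Fin n → Bool
    sym    : ∀ x y → adj x y ≡ adj y x
    irrefl : ∀ x → adj x x ≡ false
open Graph public

module _ {n : ℕ} (G : Graph n) where

  Edge : Fin n → Fin n → Set
  Edge x y = adj G x y ≡ true

  data Walk : ℕ → Fin n → Fin n → Set where
    nil  : ∀ {x} → Walk zero x x
    cons : ∀ {k x y z} → Edge x y → Walk k y z → Walk (suc k) x z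

  Dist : Fin n → ℕ → Fin n → Set
  Dist v i u = Walk i v u × (∀ j → j < i → ¬ Walk j v u)

  InLayer : Fin n → ℕ → Fin n → Set
  InLayer v i u = Dist v i u

  InComp : Fin n → Fin n → Set
  InComp v u = ∃ λ k → Walk k v u

HasSize : {n : ℕ} → (Fin n → Set) → ℕ → Set
HasSize {n} P k =
  Σ (Fin k → Fin n) λ f → Injective _≡_ _≡_ f
    × (∀ u → (P u → ∃ λ i → f i ≡ u) × (∀ i → P (f i)))

module _ {n : ℕ} (G : Graph n) where

  Regular : ℕ → Set
  Regular d = ∀ u → HasSize (Edge G u) d

  HasInDegree : Fin n → ℕ → Fin n → ℕ → Set
  HasInDegree v i u k = HasSize (λ w → Edge G u w × InLayer G v (i ∸ 1) w) k

  -- p,x,y,w,z distinct, triangle pxw, edge yz, non-edges xy, wz: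
  -- the Δ⁻-switch deletes xw, yz and inserts xy, wz.
  IsΔSwitch : (p x y w z : Fin n) → Set
  IsΔSwitch p x y w z =
    (p ≢ x × p ≢ y × p ≢ w × p ≢ z × x ≢ y × x ≢ w × x ≢ z
      × y ≢ w × y ≢ z × w ≢ z)
    × Edge G p x × Edge G p w × Edge G x w × Edge G y z
    × ¬ Edge G x y × ¬ Edge G w z

-- A vertex w ∈ V₂ has a neighbour in V₁ and ℓ − 1 in the clique V₂, hence at most d − ℓ in V₃,
-- while a vertex y ∈ V₃ has all its neighbours in V₂ ∪ V₃ (as V₄ = ∅), hence at least d − ℓ in V₃.
-- So if w ∈ V₂ is adjacent to y ∈ V₃, then y has a neighbour in V₃ not adjacent to w (otherwise y and
-- N(y) ∩ V₃ would give w more than d − ℓ neighbours in V₃).  Applying this twice from any vertex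
-- of V₃ gives x, w ∈ V₂ and an edge yz inside V₃ with xy, wz non-edges.
-- A third vertex p ∈ V₂ yields the switch on the triangle pxw and the edge yz; a common neighbour
-- p ∈ V₃ of y and z yields the switch on the triangle pyz and the edge xw.  If neither exists, then
-- V₂ = {x, w}, and N(y) ∩ V₃, N(z) ∩ V₃ are disjoint subsets of (N(x) ∪ N(w)) ∩ V₃ with at least
-- d − ℓ + 1 elements each, too many for a set of size at most 2(d − ℓ).

module Submission where

open import Defs hiding (sym)
open import Data.Nat using (ℕ; zero; suc; _≤_; _<_; _+_; _*_; _∸_; z≤n; s≤s; s≤s⁻¹)
open import Data.Nat.Properties
  using (≤-refl; ≤-trans; ≤-antisym; ≤-reflexive; <⇒≤; ≮⇒≥; <-cmp; <-irrefl; +-mono-≤; +-monoʳ-≤;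
         m≤n⇒m≤1+n; n≤1+n; +-suc; +-comm; +-commutativeSemigroup; module ≤-Reasoning)
  renaming (_≟_ to _≟ℕ_)
open import Data.Nat.Induction using (<-rec)
open import Data.Fin using (Fin; zero; suc; toℕ; fromℕ<)
open import Data.Fin.Properties using (injective⇒≤; suc-injective; 0≢1+n; any?; toℕ<n; toℕ-fromℕ<)
  renaming (_≟_ to _≟ᶠ_)
open import Data.Bool using (true)
import Data.Bool.Properties as Bool
open import Data.Product using (Σ; ∃; _×_; _,_; proj₁; proj₂)
open import Data.Sum using (_⊎_; inj₁; inj₂)
open import Data.Empty using (⊥-elim)
open import Function using (_∘_; _∘′_)
open import Level using (Level; 0ℓ)
open import Relation.Nullary using (¬_; Dec; yes; no; contradiction; ¬?)
open import Relation.Nullary.Decidable using (_×-dec_; decidable-stable)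
open import Relation.Unary using (Pred; Decidable; Empty; _⊆_; _∪_; _∩_; _⊥_; ｛_｝)
open import Relation.Unary.Properties using (_∪?_; _∩?_)
open import Relation.Binary.Definitions using (tri<; tri≈; tri>)
open import Relation.Binary.PropositionalEquality using (_≡_; _≢_; refl; sym; trans; cong; subst; ≢-sym)
open import Algebra.Properties.CommutativeSemigroup +-commutativeSemigroup using (interchange)

private variable
  ℓp ℓq : Level
  n : ℕ

count : {P : Pred (Fin n) ℓp} → Decidable P → ℕ
count {zero}  P? = 0
count {suc n} P? with P? zero
... | yes _ = suc (count (P? ∘ suc))
... | no  _ = count (P? ∘ suc)

count-⊆ : {P : Pred (Fin n) ℓp} {Q : Pred (Fin n) ℓq} (P? : Decidable P) (Q? : Decidable Q) →
          P ⊆ Q → count P? ≤ count Q?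
count-⊆ {zero}  P? Q? P⊆Q = z≤n
count-⊆ {suc n} P? Q? P⊆Q with P? zero | Q? zero
... | yes _  | yes _  = s≤s (count-⊆ (P? ∘ suc) (Q? ∘ suc) P⊆Q)
... | yes p₀ | no ¬q₀ = contradiction (P⊆Q p₀) ¬q₀
... | no _   | yes _  = m≤n⇒m≤1+n (count-⊆ (P? ∘ suc) (Q? ∘ suc) P⊆Q)
... | no _   | no _   = count-⊆ (P? ∘ suc) (Q? ∘ suc) P⊆Q

count-∪ : {P : Pred (Fin n) ℓp} {Q : Pred (Fin n) ℓq} (P? : Decidable P) (Q? : Decidable Q) →
          count (P? ∪? Q?) ≤ count P? + count Q?
count-∪ {zero}  P? Q? = z≤n
count-∪ {suc n} P? Q? with P? zero | Q? zero
... | yes _ | yes _ = s≤s (≤-trans (m≤n⇒m≤1+n (count-∪ (P? ∘ suc) (Q? ∘ suc)))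
                                   (≤-reflexive (sym (+-suc _ _))))
... | yes _ | no _  = s≤s (count-∪ (P? ∘ suc) (Q? ∘ suc))
... | no _  | yes _ = ≤-trans (s≤s (count-∪ (P? ∘ suc) (Q? ∘ suc))) (≤-reflexive (sym (+-suc _ _)))
... | no _  | no _  = count-∪ (P? ∘ suc) (Q? ∘ suc)

count-∪-disjoint : {P : Pred (Fin n) ℓp} {Q : Pred (Fin n) ℓq} (P? : Decidable P) (Q? : Decidable Q) →
                   P ⊥ Q → count P? + count Q? ≤ count (P? ∪? Q?)
count-∪-disjoint {zero}  P? Q? P⊥Q = z≤n
count-∪-disjoint {suc n} P? Q? P⊥Q with P? zero | Q? zero
... | yes p₀ | yes q₀ = ⊥-elim (P⊥Q (p₀ , q₀))
... | yes _  | no _   = s≤s (count-∪-disjoint (P? ∘ suc) (Q? ∘ suc) P⊥Q)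
... | no _   | yes _  = ≤-trans (≤-reflexive (+-suc _ _)) (s≤s (count-∪-disjoint (P? ∘ suc) (Q? ∘ suc) P⊥Q))
... | no _   | no _   = count-∪-disjoint (P? ∘ suc) (Q? ∘ suc) P⊥Q

count-⊂ : {P : Pred (Fin n) ℓp} {Q : Pred (Fin n) ℓq} (P? : Decidable P) (Q? : Decidable Q) →
          P ⊆ Q → ∀ {a} → Q a → ¬ P a → suc (count P?) ≤ count Q?
count-⊂ {suc n} P? Q? P⊆Q {a} qa ¬pa with P? zero | Q? zero | a
... | yes p₀ | no ¬q₀ | _     = contradiction (P⊆Q p₀) ¬q₀
... | yes p₀ | _      | zero  = contradiction p₀ ¬pa
... | _      | no ¬q₀ | zero  = contradiction qa ¬q₀
... | no _   | yes _  | zero  = s≤s (count-⊆ (P? ∘ suc) (Q? ∘ suc) P⊆Q)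
... | yes _  | yes _  | suc a = s≤s (count-⊂ (P? ∘ suc) (Q? ∘ suc) P⊆Q qa ¬pa)
... | no _   | yes _  | suc a = m≤n⇒m≤1+n (count-⊂ (P? ∘ suc) (Q? ∘ suc) P⊆Q qa ¬pa)
... | no _   | no _   | suc a = count-⊂ (P? ∘ suc) (Q? ∘ suc) P⊆Q qa ¬pa

count-empty : {P : Pred (Fin n) ℓp} (P? : Decidable P) → Empty P → count P? ≡ 0
count-empty {zero}  P? _ = refl
count-empty {suc n} P? ∅P with P? zero
... | yes p₀ = contradiction p₀ (∅P zero)
... | no _   = count-empty (P? ∘ suc) (∅P ∘ suc)

count-≤1 : {P : Pred (Fin n) ℓp} (P? : Decidable P) → (∀ {x y} → P x → P y → x ≡ y) → count P? ≤ 1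
count-≤1 {zero}  P? _ = z≤n
count-≤1 {suc n} P? unique with P? zero
... | yes p₀ = s≤s (≤-reflexive (count-empty (P? ∘ suc) λ x px → 0≢1+n (unique p₀ px)))
... | no _   = count-≤1 (P? ∘ suc) (λ px py → suc-injective (unique px py))

hasSize-⊆ : {P Q : Pred (Fin n) _} {a b : ℕ} → P ⊆ Q → HasSize P a → HasSize Q b → a ≤ b
hasSize-⊆ {a = a} {b} P⊆Q (f , f-inj , f-onto) (g , g-inj , g-onto) = injective⇒≤ {f = h} h-inj
  where
  preimage : ∀ i → ∃ λ j → g j ≡ f i
  preimage i = proj₁ (g-onto (f i)) (P⊆Q (proj₂ (f-onto (f i)) i))
  h : Fin a → Fin b
  h i = proj₁ (preimage i)
  h-inj : ∀ {i j} → h i ≡ h j → i ≡ j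
  h-inj {i} {j} hi≡hj = f-inj (trans (sym (proj₂ (preimage i))) (trans (cong g hi≡hj) (proj₂ (preimage j))))

enumerate : {P : Pred (Fin n) _} (P? : Decidable P) → HasSize P (count P?)
enumerate {zero}  P? = (λ ()) , (λ { {()} }) , λ ()
enumerate {suc n} {P} P? with P? zero | enumerate (P? ∘ suc)
... | yes p₀ | f , f-inj , f-onto = g , g-inj , λ u → onto u , g-in
  where
  g : Fin (suc (count (P? ∘ suc))) → Fin (suc n)
  g zero    = zero
  g (suc i) = suc (f i)
  g-inj : ∀ {i j} → g i ≡ g j → i ≡ j
  g-inj {zero}  {zero}  _ = refl
  g-inj {suc i} {suc j} e = cong suc (f-inj (suc-injective e))
  g-in : ∀ i → P (g i)
  g-in zero    = p₀
  g-in (suc i) = proj₂ (f-onto (f i)) i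
  onto : ∀ u → P u → ∃ λ i → g i ≡ u
  onto zero    _  = zero , refl
  onto (suc u) pu with proj₁ (f-onto u) pu
  ... | i , fi≡u = suc i , cong suc fi≡u
... | no ¬p₀ | f , f-inj , f-onto = suc ∘ f , f-inj ∘ suc-injective , λ u → onto u , λ i → proj₂ (f-onto (f i)) i
  where
  onto : ∀ u → P u → ∃ λ i → suc (f i) ≡ u
  onto zero    p₀ = contradiction p₀ ¬p₀
  onto (suc u) pu with proj₁ (f-onto u) pu
  ... | i , fi≡u = i , cong suc fi≡u

count-hasSize : {P : Pred (Fin n) _} (P? : Decidable P) {k : ℕ} → HasSize P k → count P? ≡ k
count-hasSize P? P-size =
  ≤-antisym (hasSize-⊆ (λ p → p) (enumerate P?) P-size) (hasSize-⊆ (λ p → p) P-size (enumerate P?))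

module Distance {n : ℕ} (G : Graph n) where

  Edge? : ∀ x y → Dec (Edge G x y)
  Edge? x y = adj G x y Bool.≟ true

  edge-sym : ∀ {x y} → Edge G x y → Edge G y x
  edge-sym {x} {y} e = trans (Graph.sym G y x) e

  edge⇒≢ : ∀ {x y} → Edge G x y → x ≢ y
  edge⇒≢ {x} e refl with trans (sym (Graph.irrefl G x)) e
  ... | ()

  snoc : ∀ {k x y z} → Walk G k x y → Edge G y z → Walk G (suc k) x z
  snoc nil         e = cons e nil
  snoc (cons e′ w) e = cons e′ (snoc w e)

  unsnoc : ∀ {k x z} → Walk G (suc k) x z → ∃ λ y → Walk G k x y × Edge G y z
  unsnoc (cons e nil) = _ , nil , e
  unsnoc (cons e (cons e′ w)) with unsnoc (cons e′ w)
  ... | y , w′ , e″ = y , cons e w′ , e″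

  walk? : ∀ k x z → Dec (Walk G k x z)
  walk? zero x z with x ≟ᶠ z
  ... | yes refl = yes nil
  ... | no x≢z   = no λ { nil → x≢z refl }
  walk? (suc k) x z with any? (λ y → Edge? x y ×-dec walk? k y z)
  ... | yes (y , e , w) = yes (cons e w)
  ... | no ∄y           = no λ { (cons e w) → ∄y (_ , e , w) }

  walk⇒dist : ∀ {k v u} → Walk G k v u → ∃ λ i → i ≤ k × Dist G v i u
  walk⇒dist {k} {v} {u} = <-rec (λ k → Walk G k v u → ∃ λ i → i ≤ k × Dist G v i u) shorten k
    where
    shorten : ∀ k → (∀ {j} → j < k → Walk G j v u → ∃ λ i → i ≤ j × Dist G v i u) →
              Walk G k v u → ∃ λ i → i ≤ k × Dist G v i u
    shorten k rec w with any? (λ (j : Fin k) → walk? (toℕ j) v u)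
    ... | yes (j , w′) with rec (toℕ<n j) w′
    ...   | i , i≤j , d = i , ≤-trans i≤j (<⇒≤ (toℕ<n j)) , d
    shorten k rec w | no ∄j = k , ≤-refl , w , λ j j<k w′ →
      ∄j (fromℕ< j<k , subst (λ m → Walk G m v u) (sym (toℕ-fromℕ< j<k)) w′)

  dist-unique : ∀ {v u i j} → Dist G v i u → Dist G v j u → i ≡ j
  dist-unique {i = i} {j} (wi , min-i) (wj , min-j) with <-cmp i j
  ... | tri< i<j _ _ = contradiction wi (min-j i i<j)
  ... | tri≈ _ i≡j _ = i≡j
  ... | tri> _ _ j<i = contradiction wj (min-i j j<i)

  layers-disjoint : ∀ {v i j a b} → InLayer G v i a → InLayer G v j b → i ≢ j → a ≢ b
  layers-disjoint ia jb i≢j refl = i≢j (dist-unique ia jb)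

  InLayer? : ∀ v i → Decidable (InLayer G v i)
  InLayer? v i u with walk? i v u
  ... | no ∄w = no (∄w ∘′ proj₁)
  ... | yes w with walk⇒dist w
  ...   | j , _ , d with j ≟ℕ i
  ...     | yes refl = yes d
  ...     | no j≢i   = no (j≢i ∘′ dist-unique d)

  layer-predecessor : ∀ {v i y} → InLayer G v (suc i) y → ∃ λ w → InLayer G v i w × Edge G w y
  layer-predecessor (w , min) with unsnoc w
  ... | x , w′ , e = x , (w′ , λ j j<i w″ → min (suc j) (s≤s j<i) (snoc w″ e)) , e

  neighbour-layer : ∀ {v i y u} → InLayer G v i y → Edge G y u →
                    ∃ λ j → InLayer G v j u × j ≤ suc i × i ≤ suc j
  neighbour-layer (w , min) e with walk⇒dist (snoc w e)
  ... | j , j≤1+i , d = j , d , j≤1+i , ≮⇒≥ λ 1+j<i → min (suc j) 1+j<i (snoc (proj₁ d) (edge-sym e))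

module Layers {n : ℕ} (G : Graph n) (v : Fin n) where

  open Distance G

  V : ℕ → Pred (Fin n) 0ℓ
  V = InLayer G v

  V? : ∀ i → Decidable (V i)
  V? = InLayer? v

  N : Fin n → ℕ → Pred (Fin n) 0ℓ
  N x i = Edge G x ∩ V i

  N? : ∀ x i → Decidable (N x i)
  N? x i = Edge? x ∩? V? i

  LocalSwitch : (p x y w z : Fin n) → Set
  LocalSwitch p x y w z =
    IsΔSwitch G p x y w z
    × (∀ t → t ≡ p ⊎ t ≡ x ⊎ t ≡ y ⊎ t ≡ w ⊎ t ≡ z → V 2 t ⊎ V 3 t)
    × ((V 2 x × V 2 w) ⊎ (V 2 y × V 2 z))
    × ¬ (V 1 x × V 1 w)
    × ¬ (V 1 y × V 1 z)
    × ¬ (V 1 x × V 1 y)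
    × ¬ (V 1 w × V 1 z)

  V₂≢V₃ : ∀ {a b} → V 2 a → V 3 b → a ≢ b
  V₂≢V₃ a∈V₂ b∈V₃ = layers-disjoint a∈V₂ b∈V₃ (λ ())

  V₂∪V₃⇒∉V₁ : ∀ {t} → V 2 t ⊎ V 3 t → ¬ V 1 t
  V₂∪V₃⇒∉V₁ (inj₁ t∈V₂) t∈V₁ = layers-disjoint t∈V₂ t∈V₁ (λ ()) refl
  V₂∪V₃⇒∉V₁ (inj₂ t∈V₃) t∈V₁ = layers-disjoint t∈V₃ t∈V₁ (λ ()) refl

  local-switch : ∀ {p x y w z} → IsΔSwitch G p x y w z →
    V 2 p ⊎ V 3 p → V 2 x ⊎ V 3 x → V 2 y ⊎ V 3 y → V 2 w ⊎ V 3 w → V 2 z ⊎ V 3 z →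
    (V 2 x × V 2 w) ⊎ (V 2 y × V 2 z) → LocalSwitch p x y w z
  local-switch {p} {x} {y} {w} {z} switch hp hx hy hw hz removed =
      switch , within , removed
    , ∉V₁ hx ∘ proj₁ , ∉V₁ hy ∘ proj₁ , ∉V₁ hx ∘ proj₁ , ∉V₁ hw ∘ proj₁
    where
    ∉V₁ = V₂∪V₃⇒∉V₁
    within : ∀ t → t ≡ p ⊎ t ≡ x ⊎ t ≡ y ⊎ t ≡ w ⊎ t ≡ z → V 2 t ⊎ V 3 t
    within _ (inj₁ refl)                      = hp
    within _ (inj₂ (inj₁ refl))               = hx
    within _ (inj₂ (inj₂ (inj₁ refl)))        = hy
    within _ (inj₂ (inj₂ (inj₂ (inj₁ refl)))) = hw
    within _ (inj₂ (inj₂ (inj₂ (inj₂ refl)))) = hz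

module SwitchSearch {n d ℓ : ℕ} (G : Graph n) (v : Fin n) (regular : Regular G d)
  (V₂-size : HasSize (InLayer G v 2) ℓ)
  (V₂-clique : ∀ x y → InLayer G v 2 x → InLayer G v 2 y → x ≢ y → Edge G x y)
  (V₄-empty : ∀ u → ¬ InLayer G v 4 u) where

  open Distance G
  open Layers G v

  degree : ∀ u → count (Edge? u) ≡ d
  degree u = count-hasSize (Edge? u) (regular u)

  count-V₂ : count (V? 2) ≡ ℓ
  count-V₂ = count-hasSize (V? 2) V₂-size

  V₃-neighbour : ∀ {y u} → V 3 y → Edge G y u → V 2 u ⊎ V 3 u
  V₃-neighbour y∈V₃ e with neighbour-layer y∈V₃ e
  ... | 2 , u∈V₂ , _ , _ = inj₁ u∈V₂
  ... | 3 , u∈V₃ , _ , _ = inj₂ u∈V₃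
  ... | 4 , u∈V₄ , _ , _ = ⊥-elim (V₄-empty _ u∈V₄)
  ... | 0 , _ , _ , s≤s ()
  ... | 1 , _ , _ , s≤s (s≤s ())
  ... | suc (suc (suc (suc (suc _)))) , _ , s≤s (s≤s (s≤s (s≤s ()))) , _

  -- V₂ and N(w) ∩ V₃ are disjoint parts of N(w) ∪ {w}, which also contains w's predecessor in V₁.
  forward-degree : ∀ {w} → V 2 w → ℓ + count (N? w 3) ≤ d
  forward-degree {w} w∈V₂ with layer-predecessor w∈V₂
  ... | p , p∈V₁ , pw = s≤s⁻¹ (begin
    suc (ℓ + count (N? w 3))              ≡⟨ cong (λ k → suc (k + count (N? w 3))) count-V₂ ⟨
    suc (count (V? 2) + count (N? w 3))   ≤⟨ s≤s (count-∪-disjoint (V? 2) (N? w 3) V₂⊥N₃[w]) ⟩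
    suc (count (V? 2 ∪? N? w 3))          ≤⟨ count-⊂ (V? 2 ∪? N? w 3) N[w]∪w? ⊆N[w]∪w (inj₁ (edge-sym pw)) p∉ ⟩
    count N[w]∪w?                         ≤⟨ count-∪ (Edge? w) (w ≟ᶠ_) ⟩
    count (Edge? w) + count (w ≟ᶠ_)       ≤⟨ +-mono-≤ (≤-reflexive (degree w)) count-w≤1 ⟩
    d + 1                                 ≡⟨ +-comm d 1 ⟩
    suc d                                 ∎)
    where
    open ≤-Reasoning
    N[w]∪w? : Decidable (Edge G w ∪ ｛ w ｝)
    N[w]∪w? = Edge? w ∪? (w ≟ᶠ_)
    count-w≤1 : count (w ≟ᶠ_) ≤ 1
    count-w≤1 = count-≤1 (w ≟ᶠ_) λ w≡x w≡y → trans (sym w≡x) w≡y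
    V₂⊥N₃[w] : V 2 ⊥ N w 3
    V₂⊥N₃[w] (u∈V₂ , _ , u∈V₃) = V₂≢V₃ u∈V₂ u∈V₃ refl
    ⊆N[w]∪w : V 2 ∪ N w 3 ⊆ Edge G w ∪ ｛ w ｝
    ⊆N[w]∪w {u} (inj₁ u∈V₂) with w ≟ᶠ u
    ... | yes w≡u = inj₂ w≡u
    ... | no w≢u  = inj₁ (V₂-clique w u w∈V₂ u∈V₂ w≢u)
    ⊆N[w]∪w (inj₂ (wu , _)) = inj₁ wu
    p∉ : ¬ (V 2 ∪ N w 3) p
    p∉ (inj₁ p∈V₂)       = layers-disjoint p∈V₂ p∈V₁ (λ ()) refl
    p∉ (inj₂ (_ , p∈V₃)) = layers-disjoint p∈V₃ p∈V₁ (λ ()) refl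

  V₃-degree : ∀ {y} → V 3 y → d ≤ count (N? y 2) + count (N? y 3)
  V₃-degree {y} y∈V₃ = begin
    d                                 ≡⟨ degree y ⟨
    count (Edge? y)                   ≤⟨ count-⊆ (Edge? y) (N? y 2 ∪? N? y 3) split ⟩
    count (N? y 2 ∪? N? y 3)          ≤⟨ count-∪ (N? y 2) (N? y 3) ⟩
    count (N? y 2) + count (N? y 3)   ∎
    where
    open ≤-Reasoning
    split : Edge G y ⊆ N y 2 ∪ N y 3
    split yu with V₃-neighbour y∈V₃ yu
    ... | inj₁ u∈V₂ = inj₁ (yu , u∈V₂)
    ... | inj₂ u∈V₃ = inj₂ (yu , u∈V₃)

  V₃-degree-bound : ∀ {y} → V 3 y → d ≤ ℓ + count (N? y 3)
  V₃-degree-bound {y} y∈V₃ = ≤-trans (V₃-degree y∈V₃) (+-mono-≤ N₂≤ℓ ≤-refl)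
    where
    N₂≤ℓ : count (N? y 2) ≤ ℓ
    N₂≤ℓ = ≤-trans (count-⊆ (N? y 2) (V? 2) proj₂) (≤-reflexive count-V₂)

  V₃-degree-gap : ∀ {x y} → V 3 y → V 2 x → ¬ Edge G y x → suc d ≤ ℓ + count (N? y 3)
  V₃-degree-gap {x} {y} y∈V₃ x∈V₂ y≁x = ≤-trans (s≤s (V₃-degree y∈V₃)) (+-mono-≤ N₂<ℓ ≤-refl)
    where
    N₂<ℓ : suc (count (N? y 2)) ≤ ℓ
    N₂<ℓ = ≤-trans (count-⊂ (N? y 2) (V? 2) proj₂ x∈V₂ (y≁x ∘ proj₁)) (≤-reflexive count-V₂)

  avoiding-V₃-neighbour : ∀ {y w} → V 3 y → V 2 w → Edge G w y → ∃ λ z → Edge G y z × V 3 z × ¬ Edge G w z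
  avoiding-V₃-neighbour {y} {w} y∈V₃ w∈V₂ wy with any? (λ z → N? y 3 z ×-dec ¬? (Edge? w z))
  ... | yes (z , (yz , z∈V₃) , w≁z) = z , yz , z∈V₃ , w≁z
  ... | no ∄z = ⊥-elim (<-irrefl refl (begin-strict
    d                         <⟨ s≤s (V₃-degree-bound y∈V₃) ⟩
    suc (ℓ + count (N? y 3))  ≡⟨ +-suc ℓ _ ⟨
    ℓ + suc (count (N? y 3))  ≤⟨ +-monoʳ-≤ ℓ N₃[y]<N₃[w] ⟩
    ℓ + count (N? w 3)        ≤⟨ forward-degree w∈V₂ ⟩
    d                         ∎))
    where
    open ≤-Reasoning
    N₃[y]⊆N₃[w] : N y 3 ⊆ N w 3
    N₃[y]⊆N₃[w] {u} (yu , u∈V₃) = decidable-stable (Edge? w u) (λ w≁u → ∄z (u , (yu , u∈V₃) , w≁u)) , u∈V₃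
    N₃[y]<N₃[w] : suc (count (N? y 3)) ≤ count (N? w 3)
    N₃[y]<N₃[w] = count-⊂ (N? y 3) (N? w 3) N₃[y]⊆N₃[w] (wy , y∈V₃) (λ (yy , _) → edge⇒≢ yy refl)

  record Configuration : Set where
    field
      x w y z : Fin n
      x∈V₂    : V 2 x
      w∈V₂    : V 2 w
      y∈V₃    : V 3 y
      z∈V₃    : V 3 z
      x≢w     : x ≢ w
      yz      : Edge G y z
      x≁y     : ¬ Edge G x y
      w≁z     : ¬ Edge G w z

  configuration : (∃ λ u → V 3 u) → Configuration
  configuration (y₀ , y₀∈V₃) with layer-predecessor y₀∈V₃
  ... | x , x∈V₂ , xy₀ with avoiding-V₃-neighbour y₀∈V₃ x∈V₂ xy₀
  ... | y , _ , y∈V₃ , x≁y with layer-predecessor y∈V₃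
  ... | w , w∈V₂ , wy with avoiding-V₃-neighbour y∈V₃ w∈V₂ wy
  ... | z , yz , z∈V₃ , w≁z = record
    { x∈V₂ = x∈V₂ ; w∈V₂ = w∈V₂ ; y∈V₃ = y∈V₃ ; z∈V₃ = z∈V₃
    ; x≢w = λ { refl → x≁y wy } ; yz = yz ; x≁y = x≁y ; w≁z = w≁z }

  module _ (c : Configuration) where
    open Configuration c

    N₃[y]-meets-N₃[z] : (∀ {u} → V 2 u → u ≡ x ⊎ u ≡ w) → ¬ (N y 3 ⊥ N z 3)
    N₃[y]-meets-N₃[z] V₂⊆xw N₃[y]⊥N₃[z] = <-irrefl refl (begin-strict
      d + d                                             <⟨ s≤s (+-monoʳ-≤ d (n≤1+n d)) ⟩
      suc d + suc d                                     ≤⟨ +-mono-≤ (V₃-degree-gap y∈V₃ x∈V₂ (x≁y ∘ edge-sym))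
                                                                    (V₃-degree-gap z∈V₃ w∈V₂ (w≁z ∘ edge-sym)) ⟩
      (ℓ + count (N? y 3)) + (ℓ + count (N? z 3))       ≡⟨ interchange ℓ _ ℓ _ ⟩
      (ℓ + ℓ) + (count (N? y 3) + count (N? z 3))       ≤⟨ +-monoʳ-≤ (ℓ + ℓ) N₃[y]+N₃[z] ⟩
      (ℓ + ℓ) + (count (N? x 3) + count (N? w 3))       ≡⟨ interchange ℓ ℓ _ _ ⟩
      (ℓ + count (N? x 3)) + (ℓ + count (N? w 3))       ≤⟨ +-mono-≤ (forward-degree x∈V₂) (forward-degree w∈V₂) ⟩
      d + d                                             ∎)
      where
      open ≤-Reasoning
      via-predecessor : ∀ {u} → V 3 u → (N x 3 ∪ N w 3) u
      via-predecessor u∈V₃ with layer-predecessor u∈V₃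
      ... | q , q∈V₂ , qu with V₂⊆xw q∈V₂
      ...   | inj₁ refl = inj₁ (qu , u∈V₃)
      ...   | inj₂ refl = inj₂ (qu , u∈V₃)
      cover : N y 3 ∪ N z 3 ⊆ N x 3 ∪ N w 3
      cover (inj₁ (_ , u∈V₃)) = via-predecessor u∈V₃
      cover (inj₂ (_ , u∈V₃)) = via-predecessor u∈V₃
      N₃[y]+N₃[z] : count (N? y 3) + count (N? z 3) ≤ count (N? x 3) + count (N? w 3)
      N₃[y]+N₃[z] = ≤-trans (count-∪-disjoint (N? y 3) (N? z 3) N₃[y]⊥N₃[z])
                    (≤-trans (count-⊆ (N? y 3 ∪? N? z 3) (N? x 3 ∪? N? w 3) cover)
                             (count-∪ (N? x 3) (N? w 3)))

    V₂-triangle-switch : ∀ {p} → V 2 p → p ≢ x → p ≢ w → LocalSwitch p x y w z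
    V₂-triangle-switch {p} p∈V₂ p≢x p≢w =
      local-switch switch (inj₁ p∈V₂) (inj₁ x∈V₂) (inj₂ y∈V₃) (inj₁ w∈V₂) (inj₂ z∈V₃) (inj₁ (x∈V₂ , w∈V₂))
      where
      switch : IsΔSwitch G p x y w z
      switch =
          ( p≢x , V₂≢V₃ p∈V₂ y∈V₃ , p≢w , V₂≢V₃ p∈V₂ z∈V₃ , V₂≢V₃ x∈V₂ y∈V₃ , x≢w , V₂≢V₃ x∈V₂ z∈V₃
          , ≢-sym (V₂≢V₃ w∈V₂ y∈V₃) , edge⇒≢ yz , V₂≢V₃ w∈V₂ z∈V₃ )
        , V₂-clique p x p∈V₂ x∈V₂ p≢x , V₂-clique p w p∈V₂ w∈V₂ p≢w , V₂-clique x w x∈V₂ w∈V₂ x≢w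
        , yz , x≁y , w≁z

    V₃-triangle-switch : ∀ {p} → V 3 p → Edge G p y → Edge G p z → LocalSwitch p y x z w
    V₃-triangle-switch {p} p∈V₃ py pz =
      local-switch switch (inj₂ p∈V₃) (inj₂ y∈V₃) (inj₁ x∈V₂) (inj₂ z∈V₃) (inj₁ w∈V₂) (inj₂ (x∈V₂ , w∈V₂))
      where
      switch : IsΔSwitch G p y x z w
      switch =
          ( edge⇒≢ py , ≢-sym (V₂≢V₃ x∈V₂ p∈V₃) , edge⇒≢ pz , ≢-sym (V₂≢V₃ w∈V₂ p∈V₃)
          , ≢-sym (V₂≢V₃ x∈V₂ y∈V₃) , edge⇒≢ yz , ≢-sym (V₂≢V₃ w∈V₂ y∈V₃)
          , V₂≢V₃ x∈V₂ z∈V₃ , x≢w , ≢-sym (V₂≢V₃ w∈V₂ z∈V₃) )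
        , py , pz , yz , V₂-clique x w x∈V₂ w∈V₂ x≢w
        , x≁y ∘ edge-sym , w≁z ∘ edge-sym

    local-switch-exists : Σ (Fin n) λ p → Σ (Fin n) λ x → Σ (Fin n) λ y → Σ (Fin n) λ w → Σ (Fin n) λ z →
                          LocalSwitch p x y w z
    local-switch-exists with any? (λ p → V? 2 p ×-dec ¬? (p ≟ᶠ x) ×-dec ¬? (p ≟ᶠ w))
    ... | yes (p , p∈V₂ , p≢x , p≢w) = p , x , y , w , z , V₂-triangle-switch p∈V₂ p≢x p≢w
    ... | no ∄p with any? (λ p → V? 3 p ×-dec Edge? p y ×-dec Edge? p z)
    ...   | yes (p , p∈V₃ , py , pz) = p , y , x , z , w , V₃-triangle-switch p∈V₃ py pz
    ...   | no ∄p′ = ⊥-elim (N₃[y]-meets-N₃[z] V₂⊆xw N₃[y]⊥N₃[z])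
      where
      V₂⊆xw : ∀ {u} → V 2 u → u ≡ x ⊎ u ≡ w
      V₂⊆xw {u} u∈V₂ with u ≟ᶠ x | u ≟ᶠ w
      ... | yes u≡x | _       = inj₁ u≡x
      ... | no _    | yes u≡w = inj₂ u≡w
      ... | no u≢x  | no u≢w  = ⊥-elim (∄p (u , u∈V₂ , u≢x , u≢w))
      N₃[y]⊥N₃[z] : N y 3 ⊥ N z 3
      N₃[y]⊥N₃[z] ((yu , u∈V₃) , (zu , _)) = ∄p′ (_ , u∈V₃ , edge-sym yu , edge-sym zu)

lemma3p9 : (n d : ℕ) (G : Graph n) (v : Fin n) →
    3 ≤ d →
    Regular G d →
    (∃ λ c → HasSize (InComp G v) c × 2 * (d + 1) ≤ c) →
    (ℓ : ℕ) → HasSize (InLayer G v 2) ℓ →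
    (∀ x y → InLayer G v 2 x → InLayer G v 2 y → x ≢ y → Edge G x y) →
    2 ≤ ℓ → ℓ ≤ d ∸ 1 →
    (∀ u → InLayer G v 2 u → HasInDegree G v 2 u 1) →
    (∃ λ u → InLayer G v 3 u) →
    (∀ u → ¬ InLayer G v 4 u) →
    Σ (Fin n) λ p → Σ (Fin n) λ x → Σ (Fin n) λ y → Σ (Fin n) λ w → Σ (Fin n) λ z →
      IsΔSwitch G p x y w z
      × (∀ t → t ≡ p ⊎ t ≡ x ⊎ t ≡ y ⊎ t ≡ w ⊎ t ≡ z →
           InLayer G v 2 t ⊎ InLayer G v 3 t)
      × ((InLayer G v 2 x × InLayer G v 2 w) ⊎ (InLayer G v 2 y × InLayer G v 2 z))
      × ¬ (InLayer G v 1 x × InLayer G v 1 w)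
      × ¬ (InLayer G v 1 y × InLayer G v 1 z)
      × ¬ (InLayer G v 1 x × InLayer G v 1 y)
      × ¬ (InLayer G v 1 w × InLayer G v 1 z)
lemma3p9 n d G v _ regular _ ℓ V₂-size V₂-clique _ _ _ V₃-nonempty V₄-empty =
  local-switch-exists (configuration V₃-nonempty)
  where open SwitchSearch G v regular V₂-size V₂-clique V₄-empty
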